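{- Let $\mathcal G$ be a finite abelian group and let $G,H$ be finite simple graphs. If $H$ is a minor of $G$ and $H$ is zero-forcing for $\mathcal G$, then $G$ is zero-forcing for $\mathcal G$.
   Context: For a finite abelian group $(\mathcal G,+,0)$, a $\mathcal G$-labeling of a graph $G$ is a map $\ell: V(G)\to\mathcal G$, extended to vertex sets by $\ell(A)=\sum_{x\in A}\ell(x)$. A set $A\subseteq V(G)$ is called connected if $G[A]$ is connected. The labeled graph $(G,\ell)$ is zero-avoiding if $\ell(A)\neq 0$ for every non-empty connected $A\subseteq V(G)$. The graph $G$ is zero-forcing for $\mathcal G$ if there is no $\mathcal G$-labeling $\ell$ of $G$ such that $(G,\ell)$ is zero-avoiding. -}

module Defs where

open import Level using (Level; _⊔_; suc)
open import Data.Nat using (ℕ)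
open import Data.Fin using (Fin)
open import Data.Bool using (Bool; true; false; if_then_else_)
open import Data.Product using (Σ; ∃; _×_; _,_)
open import Relation.Binary.PropositionalEquality using (_≡_)
open import Relation.Nullary using (¬_)
open import Algebra.Bundles using (AbelianGroup)

record Graph : Set where
  field
    n      : ℕ
    adj    : Fin n → Fin n → Bool
    sym    : ∀ x y → adj x y ≡ adj y x
    irrefl : ∀ x → adj x x ≡ false
open Graph public

VSet : Graph → Set
VSet G = Fin (n G) → Bool

-- Walks in G from x to y all of whose vertices lie in A (x itself assumed in A).
data WalkIn (G : Graph) (A : VSet G) : Fin (n G) → Fin (n G) → Set where
  here : ∀ {x} → WalkIn G A x x
  step : ∀ {x y z} → adj G x y ≡ true → A y ≡ true → WalkIn G A y z → WalkIn G A x z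

Connected : (G : Graph) → VSet G → Set
Connected G A = ∀ x y → A x ≡ true → A y ≡ true → WalkIn G A x y

NonEmpty : (G : Graph) → VSet G → Set
NonEmpty G A = ∃ λ x → A x ≡ true

IsFinite : ∀ {c ℓ} → AbelianGroup c ℓ → Set (c ⊔ ℓ)
IsFinite 𝒢 = ∃ λ (m : ℕ) → Σ (Fin m → Carrier) λ f → ∀ x → ∃ λ i → f i ≈ x
  where open AbelianGroup 𝒢

module _ {c ℓ} (𝒢 : AbelianGroup c ℓ) where
  open AbelianGroup 𝒢

  Σfin : ∀ {k} → (Fin k → Carrier) → Carrier
  Σfin {ℕ.zero}  f = ε
  Σfin {ℕ.suc k} f = f Fin.zero ∙ Σfin (λ i → f (Fin.suc i))

  Labeling : Graph → Set c
  Labeling G = Fin (n G) → Carrier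

  labelSum : (G : Graph) → Labeling G → VSet G → Carrier
  labelSum G lab A = Σfin (λ x → if A x then lab x else ε)

  ZeroAvoiding : (G : Graph) → Labeling G → Set (ℓ)
  ZeroAvoiding G lab = ∀ (A : VSet G) → NonEmpty G A → Connected G A → ¬ (labelSum G lab A ≈ ε)

  ZeroForcing : Graph → Set (c ⊔ ℓ)
  ZeroForcing G = ¬ (Σ (Labeling G) λ lab → ZeroAvoiding G lab)

record MinorModel (H G : Graph) : Set where
  field
    branch    : Fin (n H) → VSet G
    nonempty  : ∀ v → NonEmpty G (branch v)
    connected : ∀ v → Connected G (branch v)
    disjoint  : ∀ u v x → ¬ (u ≡ v) → branch u x ≡ true → branch v x ≡ false
    edges     : ∀ u v → adj H u v ≡ true →
                ∃ λ x → ∃ λ y → branch u x ≡ true × branch v y ≡ true × adj G x y ≡ true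

IsMinor : Graph → Graph → Set
IsMinor H G = MinorModel H G

-- Contract the branch sets of a minor model: a labeling ℓ of G induces the labeling
-- v ↦ ℓ(B v) of H.  For a non-empty connected set A of H the union of the branch sets
-- of A is non-empty and connected in G (walks in H lift through the edges between branch
-- sets and the connectivity inside each branch set), and by disjointness its label is
-- the induced label of A.  So a zero-avoiding labeling of G gives one of H.
module Submission where

open import Defs hiding (sym)
open import Algebra.Bundles using (AbelianGroup)
open import Data.Nat using (zero; suc)
open import Data.Fin using (Fin) renaming (zero to fzero; suc to fsuc)
open import Data.Fin.Properties using (suc-injective)
open import Data.Bool using (Bool; true; false; _∧_; _∨_; if_then_else_)
open import Data.Bool.Properties using (∧-conicalˡ; ∧-conicalʳ)
open import Data.Product using (∃; _×_; _,_)
open import Relation.Binary.PropositionalEquality using (_≡_; refl; cong₂)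
open import Relation.Nullary using (¬_)
import Algebra.Properties.CommutativeSemigroup as CommutativeSemigroupProperties
import Relation.Binary.Reasoning.Setoid as SetoidReasoning

anyFin : ∀ {m} → (Fin m → Bool) → Bool
anyFin {zero}  c = false
anyFin {suc m} c = c fzero ∨ anyFin (λ i → c (fsuc i))

anyFin-intro : ∀ {m} (c : Fin m → Bool) v → c v ≡ true → anyFin c ≡ true
anyFin-intro c fzero    cv with c fzero
... | true = refl
anyFin-intro c (fsuc v) cv with c fzero
... | true  = refl
... | false = anyFin-intro (λ i → c (fsuc i)) v cv

anyFin-elim : ∀ {m} (c : Fin m → Bool) → anyFin c ≡ true → ∃ λ v → c v ≡ true
anyFin-elim {suc m} c any with c fzero in cz
... | true  = fzero , cz
... | false with anyFin-elim (λ i → c (fsuc i)) any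
...   | v , cv = fsuc v , cv

∧-true⁻ : ∀ {a b} → a ∧ b ≡ true → a ≡ true × b ≡ true
∧-true⁻ {a} {b} ab = ∧-conicalˡ a b ab , ∧-conicalʳ a b ab

if-∧ : ∀ {a} {X : Set a} (p q : Bool) (x z : X) →
       (if p ∧ q then x else z) ≡ (if p then (if q then x else z) else z)
if-∧ true  q x z = refl
if-∧ false q x z = refl

module _ (G : Graph) where

  WalkIn-mono : ∀ {A A′ : VSet G} → (∀ x → A x ≡ true → A′ x ≡ true) →
                ∀ {x y} → WalkIn G A x y → WalkIn G A′ x y
  WalkIn-mono A⊆A′ here          = here
  WalkIn-mono A⊆A′ (step e a w) = step e (A⊆A′ _ a) (WalkIn-mono A⊆A′ w)

  WalkIn-++ : ∀ {A : VSet G} {x y z} → WalkIn G A x y → WalkIn G A y z → WalkIn G A x z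
  WalkIn-++ here          w′ = w′
  WalkIn-++ (step e a w) w′ = step e a (WalkIn-++ w w′)

module FiniteSums {c ℓ} (𝒢 : AbelianGroup c ℓ) where
  open AbelianGroup 𝒢 renaming (refl to ≈-refl)
  open SetoidReasoning setoid
  open CommutativeSemigroupProperties commutativeSemigroup using (interchange)

  Σ : ∀ {k} → (Fin k → Carrier) → Carrier
  Σ = Σfin 𝒢

  Σ-cong : ∀ {k} {f g : Fin k → Carrier} → (∀ i → f i ≈ g i) → Σ f ≈ Σ g
  Σ-cong {zero}  f≈g = ≈-refl
  Σ-cong {suc k} f≈g = ∙-cong (f≈g fzero) (Σ-cong (λ i → f≈g (fsuc i)))

  Σ-zero : ∀ {k} (f : Fin k → Carrier) → (∀ i → f i ≈ ε) → Σ f ≈ ε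
  Σ-zero {zero}  f f≈ε = ≈-refl
  Σ-zero {suc k} f f≈ε = trans (∙-cong (f≈ε fzero) (Σ-zero _ (λ i → f≈ε (fsuc i)))) (identityˡ ε)

  Σ-distrib : ∀ {k} (f g : Fin k → Carrier) → Σ (λ i → f i ∙ g i) ≈ Σ f ∙ Σ g
  Σ-distrib {zero}  f g = sym (identityˡ ε)
  Σ-distrib {suc k} f g = begin
      (f fzero ∙ g fzero) ∙ Σ (λ i → f (fsuc i) ∙ g (fsuc i))
    ≈⟨ ∙-cong ≈-refl (Σ-distrib (λ i → f (fsuc i)) (λ i → g (fsuc i))) ⟩
      (f fzero ∙ g fzero) ∙ (Σ (λ i → f (fsuc i)) ∙ Σ (λ i → g (fsuc i)))
    ≈⟨ interchange _ _ _ _ ⟩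
      (f fzero ∙ Σ (λ i → f (fsuc i))) ∙ (g fzero ∙ Σ (λ i → g (fsuc i))) ∎

  Σ-comm : ∀ {k m} (g : Fin k → Fin m → Carrier) →
           Σ (λ v → Σ (λ x → g v x)) ≈ Σ (λ x → Σ (λ v → g v x))
  Σ-comm {zero}  {m} g = sym (Σ-zero {m} (λ _ → ε) (λ _ → ≈-refl))
  Σ-comm {suc k} g = begin
      Σ (g fzero) ∙ Σ (λ v → Σ (λ x → g (fsuc v) x))
    ≈⟨ ∙-cong ≈-refl (Σ-comm (λ v → g (fsuc v))) ⟩
      Σ (g fzero) ∙ Σ (λ x → Σ (λ v → g (fsuc v) x))
    ≈⟨ sym (Σ-distrib (g fzero) (λ x → Σ (λ v → g (fsuc v) x))) ⟩
      Σ (λ x → Σ (λ v → g v x)) ∎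

  if-Σ : ∀ {k} (b : Bool) (f : Fin k → Carrier) →
         (if b then Σ f else ε) ≈ Σ (λ i → if b then f i else ε)
  if-Σ     true  f = ≈-refl
  if-Σ {k} false f = sym (Σ-zero {k} (λ _ → ε) (λ _ → ≈-refl))

  Σ-indicator : ∀ {m} (c : Fin m → Bool) (a : Carrier) →
                (∀ u v → ¬ (u ≡ v) → c u ≡ true → c v ≡ false) →
                Σ (λ v → if c v then a else ε) ≈ (if anyFin c then a else ε)
  Σ-indicator {zero}  c a atMostOne = ≈-refl
  Σ-indicator {suc m} c a atMostOne with c fzero in cz
  ... | true  = trans (∙-cong ≈-refl (Σ-zero _ restZero)) (identityʳ a)
    where
    restZero : ∀ i → (if c (fsuc i) then a else ε) ≈ ε
    restZero i with c (fsuc i) | atMostOne fzero (fsuc i) (λ ()) cz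
    ... | false | _ = ≈-refl
  ... | false = trans (identityˡ _) (Σ-indicator (λ i → c (fsuc i)) a
                  (λ u v u≢v → atMostOne (fsuc u) (fsuc v) (λ eq → u≢v (suc-injective eq))))

module Contraction {H G : Graph} (M : MinorModel H G) where
  open MinorModel M

  branchUnion : VSet H → VSet G
  branchUnion A x = anyFin (λ v → A v ∧ branch v x)

  ⊆-branchUnion : ∀ {A} v x → A v ≡ true → branch v x ≡ true → branchUnion A x ≡ true
  ⊆-branchUnion {A} v x av bx = anyFin-intro (λ v → A v ∧ branch v x) v (cong₂ _∧_ av bx)

  branchUnion-nonEmpty : ∀ {A} → NonEmpty H A → NonEmpty G (branchUnion A)
  branchUnion-nonEmpty (v , av) with nonempty v
  ... | x , bx = x , ⊆-branchUnion v x av bx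

  liftWalk : ∀ {A u w} → A u ≡ true → WalkIn H A u w →
             ∀ x y → branch u x ≡ true → branch w y ≡ true → WalkIn G (branchUnion A) x y
  liftWalk {u = u} au here x y bx by =
    WalkIn-mono G (λ z → ⊆-branchUnion u z au) (connected u x y bx by)
  liftWalk {u = u} au (step {y = u′} e au′ rest) x y bx by with edges u u′ e
  ... | a , b , ba , bb , ab =
    WalkIn-++ G (WalkIn-mono G (λ z → ⊆-branchUnion u z au) (connected u x a bx ba))
                (step ab (⊆-branchUnion u′ b au′ bb) (liftWalk au′ rest b y bb by))

  branchUnion-connected : ∀ {A} → Connected H A → Connected G (branchUnion A)
  branchUnion-connected {A} connA x y ux uy
    with anyFin-elim (λ v → A v ∧ branch v x) ux | anyFin-elim (λ v → A v ∧ branch v y) uy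
  ... | u , p | w , q with ∧-true⁻ p | ∧-true⁻ q
  ... | au , bx | aw , by = liftWalk au (connA u w au aw) x y bx by

  module _ {c ℓ} (𝒢 : AbelianGroup c ℓ) where
    open AbelianGroup 𝒢 hiding (refl)
    open FiniteSums 𝒢
    open SetoidReasoning setoid

    contractLabeling : Labeling 𝒢 G → Labeling 𝒢 H
    contractLabeling lab v = labelSum 𝒢 G lab (branch v)

    branchUnion-labelSum : ∀ lab A →
      labelSum 𝒢 G lab (branchUnion A) ≈ labelSum 𝒢 H (contractLabeling lab) A
    branchUnion-labelSum lab A = begin
        Σ (λ x → if branchUnion A x then lab x else ε)
      ≈⟨ Σ-cong (λ x → sym (Σ-indicator (λ v → A v ∧ branch v x) (lab x) (atMostOne x))) ⟩
        Σ (λ x → Σ (λ v → if A v ∧ branch v x then lab x else ε))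
      ≈⟨ Σ-cong (λ x → Σ-cong (λ v → reflexive (if-∧ (A v) (branch v x) (lab x) ε))) ⟩
        Σ (λ x → Σ (λ v → if A v then (if branch v x then lab x else ε) else ε))
      ≈⟨ sym (Σ-comm (λ v x → if A v then (if branch v x then lab x else ε) else ε)) ⟩
        Σ (λ v → Σ (λ x → if A v then (if branch v x then lab x else ε) else ε))
      ≈⟨ Σ-cong (λ v → sym (if-Σ (A v) (λ x → if branch v x then lab x else ε))) ⟩
        Σ (λ v → if A v then contractLabeling lab v else ε) ∎
      where
      atMostOne : ∀ x u w → ¬ (u ≡ w) → A u ∧ branch u x ≡ true → A w ∧ branch w x ≡ false
      atMostOne x u w u≢w p with A w
      ... | false = refl
      ... | true  = disjoint u w x u≢w (∧-conicalʳ (A u) (branch u x) p)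

    contractLabeling-zeroAvoiding : ∀ lab → ZeroAvoiding 𝒢 G lab → ZeroAvoiding 𝒢 H (contractLabeling lab)
    contractLabeling-zeroAvoiding lab zaG A neA connA sum≈ε =
      zaG (branchUnion A) (branchUnion-nonEmpty neA) (branchUnion-connected connA)
          (trans (branchUnion-labelSum lab A) sum≈ε)

proposition2p1 : ∀ {c ℓ} (𝒢 : AbelianGroup c ℓ) → IsFinite 𝒢 →
    (G H : Graph) → IsMinor H G → ZeroForcing 𝒢 H → ZeroForcing 𝒢 G
proposition2p1 𝒢 _ G H M zfH (lab , zaG) =
  zfH (contractLabeling 𝒢 lab , contractLabeling-zeroAvoiding 𝒢 lab zaG)
  where open Contraction M
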